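{- Let $G$ be a reflexive graph. Then $G$ is a strong cocomparability graph if and only if $G$ admits a linear ordering $\prec$ of its vertices that contains none of the following four ordered induced patterns: (P1) vertices $a\prec b\prec c$ with $ac\in E(G)$ and $ab,bc\notin E(G)$; (P2) vertices $a\prec b\prec c\prec d$ with $ac,bd,bc\in E(G)$ and $ab,ad,cd\notin E(G)$; (P3) vertices $a\prec b\prec c\prec d$ with $ac,bd,ad,bc\in E(G)$ and $ab,cd\notin E(G)$; (P4) vertices $a\prec b\prec c\prec d$ with $ab,bc,cd,ad\in E(G)$ and $ac,bd\notin E(G)$.
   Context: A reflexive graph is a finite undirected graph in which every vertex has a loop; its adjacency matrix is a symmetric $0,1$-matrix with $1$'s on the main diagonal. A symmetric ordering of a symmetric matrix is a matrix obtained by simultaneously permuting its rows and columns (equivalently, reordering the vertices). A matrix $M$ contains the Slash matrix $\begin{pmatrix}0&1\\1&0\end{pmatrix}$ if there are rows $i_1<i_2$ and columns $j_1<j_2$ (not necessarily consecutive) with $M(i_1,j_1)=0$, $M(i_1,j_2)=1$, $M(i_2,j_1)=1$, $M(i_2,j_2)=0$. A reflexive graph is a strong cocomparability graph if its adjacency matrix admits a symmetric ordering that does not contain the Slash matrix. -}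

module Defs where

open import Data.Nat using (ℕ)
open import Data.Bool using (Bool; true; false)
open import Data.Fin using (Fin; _<_)
open import Data.Fin.Permutation using (Permutation′; _⟨$⟩ʳ_)
open import Data.Product using (_×_; ∃-syntax)
open import Data.Sum using (_⊎_)
open import Relation.Nullary using (¬_)
open import Relation.Binary.PropositionalEquality using (_≡_)

record ReflexiveGraph (n : ℕ) : Set where
  field
    adj     : Fin n → Fin n → Bool
    adj-sym : ∀ i j → adj i j ≡ adj j i
    adj-refl : ∀ i → adj i i ≡ true

open ReflexiveGraph public

Matrix : ℕ → Set
Matrix n = Fin n → Fin n → Bool

symOrdering : ∀ {n} → ReflexiveGraph n → Permutation′ n → Matrix n
symOrdering G π i j = adj G (π ⟨$⟩ʳ i) (π ⟨$⟩ʳ j)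

ContainsSlash : ∀ {n} → Matrix n → Set
ContainsSlash {n} M =
  ∃[ i₁ ] ∃[ i₂ ] ∃[ j₁ ] ∃[ j₂ ]
    (i₁ < i₂ × j₁ < j₂ ×
     M i₁ j₁ ≡ false × M i₁ j₂ ≡ true ×
     M i₂ j₁ ≡ true × M i₂ j₂ ≡ false)

StrongCocomparability : ∀ {n} → ReflexiveGraph n → Set
StrongCocomparability G = ∃[ π ] ¬ ContainsSlash (symOrdering G π)

-- A linear ordering of the vertices is given by a permutation π:
-- vertex π(p) is at position p, so  π(p) ≺ π(q)  iff  p < q.
module _ {n : ℕ} (G : ReflexiveGraph n) (π : Permutation′ n) where
  private
    E : Fin n → Fin n → Bool
    E p q = adj G (π ⟨$⟩ʳ p) (π ⟨$⟩ʳ q)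

  HasP1 : Set
  HasP1 = ∃[ a ] ∃[ b ] ∃[ c ]
    (a < b × b < c × E a c ≡ true × E a b ≡ false × E b c ≡ false)

  HasP2 : Set
  HasP2 = ∃[ a ] ∃[ b ] ∃[ c ] ∃[ d ]
    (a < b × b < c × c < d ×
     E a c ≡ true × E b d ≡ true × E b c ≡ true ×
     E a b ≡ false × E a d ≡ false × E c d ≡ false)

  HasP3 : Set
  HasP3 = ∃[ a ] ∃[ b ] ∃[ c ] ∃[ d ]
    (a < b × b < c × c < d ×
     E a c ≡ true × E b d ≡ true × E a d ≡ true × E b c ≡ true ×
     E a b ≡ false × E c d ≡ false)

  HasP4 : Set
  HasP4 = ∃[ a ] ∃[ b ] ∃[ c ] ∃[ d ]
    (a < b × b < c × c < d ×
     E a b ≡ true × E b c ≡ true × E c d ≡ true × E a d ≡ true ×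
     E a c ≡ false × E b d ≡ false)

  AvoidsPatterns : Set
  AvoidsPatterns = ¬ HasP1 × ¬ HasP2 × ¬ HasP3 × ¬ HasP4

{-# OPTIONS --safe #-}
-- Each pattern is already a Slash of the ordered matrix (for P1 the middle
-- vertex serves as both a row and a column, thanks to its loop). Conversely,
-- given a Slash in rows r₁ < r₂ and columns c₁ < c₂, symmetry lets us swap
-- rows and columns so that r₁ < c₁ (the loops exclude r₁ = c₁); locating r₂
-- relative to c₁ and c₂ and asking whether r₁r₂ and c₁c₂ are edges then
-- produces one of P1–P4.
module Submission where

open import Defs
open import Data.Nat using (ℕ)
open import Data.Product using (_×_; ∃-syntax; _,_)
open import Data.Bool using (true; false)
open import Data.Sum using (_⊎_; inj₁; inj₂)
open import Data.Fin using (Fin; _<_)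
open import Data.Fin.Properties using (<-cmp; <-trans)
open import Data.Fin.Permutation using (Permutation′; _⟨$⟩ʳ_)
open import Relation.Nullary using (¬_; contradiction)
open import Relation.Binary.Definitions using (tri<; tri≈; tri>)
open import Relation.Binary.PropositionalEquality using (_≡_; refl; sym; trans)

module _ {n : ℕ} (G : ReflexiveGraph n) (π : Permutation′ n) where
  private
    E : Matrix n
    E = symOrdering G π

  E-sym : ∀ p q → E p q ≡ E q p
  E-sym p q = adj-sym G (π ⟨$⟩ʳ p) (π ⟨$⟩ʳ q)

  E-diagonal-not-false : ∀ {p} → ¬ E p p ≡ false
  E-diagonal-not-false {p} Epp≡false with trans (sym (adj-refl G (π ⟨$⟩ʳ p))) Epp≡false
  ... | ()

  HasPattern : Set
  HasPattern = HasP1 G π ⊎ HasP2 G π ⊎ HasP3 G π ⊎ HasP4 G π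

  avoidsPatterns⇒¬hasPattern : AvoidsPatterns G π → ¬ HasPattern
  avoidsPatterns⇒¬hasPattern (¬p1 , _ , _ , _) (inj₁ p) = ¬p1 p
  avoidsPatterns⇒¬hasPattern (_ , ¬p2 , _ , _) (inj₂ (inj₁ p)) = ¬p2 p
  avoidsPatterns⇒¬hasPattern (_ , _ , ¬p3 , _) (inj₂ (inj₂ (inj₁ p))) = ¬p3 p
  avoidsPatterns⇒¬hasPattern (_ , _ , _ , ¬p4) (inj₂ (inj₂ (inj₂ p))) = ¬p4 p

  P1⇒slash : HasP1 G π → ContainsSlash E
  P1⇒slash (a , b , c , a<b , b<c , ac , ¬ab , ¬bc) =
    a , b , b , c , a<b , b<c , ¬ab , ac , adj-refl G (π ⟨$⟩ʳ b) , ¬bc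

  P2⇒slash : HasP2 G π → ContainsSlash E
  P2⇒slash (a , b , c , d , a<b , b<c , c<d , ac , bd , _ , ¬ab , _ , ¬cd) =
    a , d , b , c , <-trans a<b (<-trans b<c c<d) , b<c ,
    ¬ab , ac , trans (E-sym d b) bd , trans (E-sym d c) ¬cd

  P3⇒slash : HasP3 G π → ContainsSlash E
  P3⇒slash (a , b , c , d , a<b , b<c , c<d , _ , _ , ad , bc , ¬ab , ¬cd) =
    a , c , b , d , <-trans a<b b<c , <-trans b<c c<d ,
    ¬ab , ad , trans (E-sym c b) bc , ¬cd

  P4⇒slash : HasP4 G π → ContainsSlash E
  P4⇒slash (a , b , c , d , a<b , _ , c<d , _ , bc , _ , ad , ¬ac , ¬bd) =
    a , b , c , d , a<b , c<d , ¬ac , ad , bc , ¬bd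

  ¬slash⇒avoidsPatterns : ¬ ContainsSlash E → AvoidsPatterns G π
  ¬slash⇒avoidsPatterns ¬slash =
    (λ p → ¬slash (P1⇒slash p)) , (λ p → ¬slash (P2⇒slash p)) ,
    (λ p → ¬slash (P3⇒slash p)) , (λ p → ¬slash (P4⇒slash p))

  record LeadingRowSlash (r₁ r₂ c₁ c₂ : Fin n) : Set where
    field
      r₁<r₂ : r₁ < r₂
      c₁<c₂ : c₁ < c₂
      r₁<c₁ : r₁ < c₁
      ¬r₁c₁ : E r₁ c₁ ≡ false
      r₁c₂  : E r₁ c₂ ≡ true
      r₂c₁  : E r₂ c₁ ≡ true
      ¬r₂c₂ : E r₂ c₂ ≡ false

  slash⇒leadingRowSlash : ContainsSlash E → ∃[ r₁ ] ∃[ r₂ ] ∃[ c₁ ] ∃[ c₂ ] LeadingRowSlash r₁ r₂ c₁ c₂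
  slash⇒leadingRowSlash (r₁ , r₂ , c₁ , c₂ , r₁<r₂ , c₁<c₂ , ¬r₁c₁ , r₁c₂ , r₂c₁ , ¬r₂c₂)
    with <-cmp r₁ c₁
  ... | tri< r₁<c₁ _ _ =
    r₁ , r₂ , c₁ , c₂ , record
      { r₁<r₂ = r₁<r₂ ; c₁<c₂ = c₁<c₂ ; r₁<c₁ = r₁<c₁
      ; ¬r₁c₁ = ¬r₁c₁ ; r₁c₂ = r₁c₂ ; r₂c₁ = r₂c₁ ; ¬r₂c₂ = ¬r₂c₂ }
  ... | tri≈ _ refl _ = contradiction ¬r₁c₁ E-diagonal-not-false
  ... | tri> _ _ c₁<r₁ =
    c₁ , c₂ , r₁ , r₂ , record
      { r₁<r₂ = c₁<c₂ ; c₁<c₂ = r₁<r₂ ; r₁<c₁ = c₁<r₁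
      ; ¬r₁c₁ = trans (E-sym c₁ r₁) ¬r₁c₁ ; r₁c₂ = trans (E-sym c₁ r₂) r₂c₁
      ; r₂c₁ = trans (E-sym c₂ r₁) r₁c₂ ; ¬r₂c₂ = trans (E-sym c₂ r₂) ¬r₂c₂ }

  module _ {r₁ r₂ c₁ c₂ : Fin n} (s : LeadingRowSlash r₁ r₂ c₁ c₂) where
    open LeadingRowSlash s

    ¬c₁c₂⇒P1 : E c₁ c₂ ≡ false → HasP1 G π
    ¬c₁c₂⇒P1 ¬c₁c₂ = r₁ , c₁ , c₂ , r₁<c₁ , c₁<c₂ , r₁c₂ , ¬r₁c₁ , ¬c₁c₂

    ¬r₁r₂⇒P1 : r₂ < c₂ → E r₁ r₂ ≡ false → HasP1 G π
    ¬r₁r₂⇒P1 r₂<c₂ ¬r₁r₂ = r₁ , r₂ , c₂ , r₁<r₂ , r₂<c₂ , r₁c₂ , ¬r₁r₂ , ¬r₂c₂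

    leadingRowSlash⇒pattern : HasPattern
    leadingRowSlash⇒pattern with E c₁ c₂ in c₁c₂
    ... | false = inj₁ (¬c₁c₂⇒P1 c₁c₂)
    ... | true with <-cmp r₂ c₁
    ...   | tri≈ _ refl _ = inj₁ (¬r₁r₂⇒P1 c₁<c₂ ¬r₁c₁)
    ...   | tri< r₂<c₁ _ _ with E r₁ r₂ in r₁r₂
    ...     | false = inj₁ (¬r₁r₂⇒P1 (<-trans r₂<c₁ c₁<c₂) r₁r₂)
    ...     | true = inj₂ (inj₂ (inj₂
                (r₁ , r₂ , c₁ , c₂ , r₁<r₂ , r₂<c₁ , c₁<c₂ ,
                 r₁r₂ , r₂c₁ , c₁c₂ , r₁c₂ , ¬r₁c₁ , ¬r₂c₂)))
    leadingRowSlash⇒pattern | true | tri> _ _ c₁<r₂ with <-cmp r₂ c₂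
    ...   | tri≈ _ refl _ = contradiction ¬r₂c₂ E-diagonal-not-false
    ...   | tri< r₂<c₂ _ _ with E r₁ r₂ in r₁r₂
    ...     | false = inj₁ (¬r₁r₂⇒P1 r₂<c₂ r₁r₂)
    ...     | true = inj₂ (inj₂ (inj₁
                (r₁ , c₁ , r₂ , c₂ , r₁<c₁ , c₁<r₂ , r₂<c₂ ,
                 r₁r₂ , c₁c₂ , r₁c₂ , trans (E-sym c₁ r₂) r₂c₁ , ¬r₁c₁ , ¬r₂c₂)))
    leadingRowSlash⇒pattern | true | tri> _ _ c₁<r₂ | tri> _ _ c₂<r₂ with E r₁ r₂ in r₁r₂
    ...     | true = inj₂ (inj₂ (inj₁
                (r₁ , c₁ , c₂ , r₂ , r₁<c₁ , c₁<c₂ , c₂<r₂ ,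
                 r₁c₂ , trans (E-sym c₁ r₂) r₂c₁ , r₁r₂ , c₁c₂ ,
                 ¬r₁c₁ , trans (E-sym c₂ r₂) ¬r₂c₂)))
    ...     | false = inj₂ (inj₁
                (r₁ , c₁ , c₂ , r₂ , r₁<c₁ , c₁<c₂ , c₂<r₂ ,
                 r₁c₂ , trans (E-sym c₁ r₂) r₂c₁ , c₁c₂ ,
                 ¬r₁c₁ , r₁r₂ , trans (E-sym c₂ r₂) ¬r₂c₂))

  avoidsPatterns⇒¬slash : AvoidsPatterns G π → ¬ ContainsSlash E
  avoidsPatterns⇒¬slash avoids slash with slash⇒leadingRowSlash slash
  ... | _ , _ , _ , _ , s = avoidsPatterns⇒¬hasPattern avoids (leadingRowSlash⇒pattern s)

proposition6 : ∀ {n : ℕ} (G : ReflexiveGraph n) →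
    (StrongCocomparability G → ∃[ π ] AvoidsPatterns G π) ×
    (∃[ π ] AvoidsPatterns G π → StrongCocomparability G)
proposition6 G =
  (λ (π , ¬slash) → π , ¬slash⇒avoidsPatterns G π ¬slash) ,
  (λ (π , avoids) → π , avoidsPatterns⇒¬slash G π avoids)
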